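{- If a graph is $(d,\Delta)$-degenerate, then it is $\left(\Delta(d-1)+1\right)$-arrangeable.
   Context: A graph $H$ is $(d,\Delta)$-degenerate if there is an ordering $v_1,\ldots,v_n$ of its vertices such that for each $v_i$: (1) at most $d$ vertices $v_j$ with $j<i$ are adjacent to $v_i$, and (2) there are at most $\Delta$ subsets $S\subset\{v_1,\ldots,v_i\}$ such that $S=N(v_j)\cap\{v_1,\ldots,v_i\}$ for some neighbor $v_j$ of $v_i$ with $j>i$, where $N(v)$ is the set of neighbors of $v$. A graph is $p$-arrangeable if there is an ordering $v_1,\ldots,v_n$ of its vertices such that for every $v_i$, the neighbors of $v_i$ among $\{v_j: j>i\}$ have together at most $p$ neighbors among $\{v_1,\ldots,v_i\}$ (including $v_i$). -}

module Defs where

open import Data.Nat using (ℕ; _≤_; _<_; _∸_; _*_; _+_)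
open import Data.Bool using (Bool; true; false; _∧_; T)
open import Data.Fin using (Fin; toℕ; _≤?_; _<?_)
open import Data.Fin.Subset using (Subset; ∣_∣)
open import Data.Vec using (tabulate)
open import Data.List using (List; length)
open import Data.Bool.ListAction using (any)
open import Data.List.Membership.Propositional using (_∈_)
open import Data.Fin.Permutation using (Permutation′; _⟨$⟩ʳ_)
open import Data.Product using (Σ; _×_)
open import Relation.Binary.PropositionalEquality using (_≡_)
open import Relation.Nullary.Decidable using (⌊_⌋)
open import Data.List using (allFin)

record Graph (n : ℕ) : Set where
  field
    adj    : Fin n → Fin n → Bool
    sym    : ∀ u v → adj u v ≡ adj v u
    irrefl : ∀ v → adj v v ≡ false
open Graph public

-- An ordering v_1,…,v_n of the vertices: a bijection from positions to
-- vertices.  Position i holds vertex  σ ⟨$⟩ʳ i.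
Ordering : ℕ → Set
Ordering n = Permutation′ n

module _ {n : ℕ} (G : Graph n) (σ : Ordering n) where

  A : Fin n → Fin n → Bool
  A i j = adj G (σ ⟨$⟩ʳ i) (σ ⟨$⟩ʳ j)

  backNbrs : Fin n → Subset n
  backNbrs i = tabulate (λ j → ⌊ j <? i ⌋ ∧ A i j)

  trace : Fin n → Fin n → Subset n
  trace i j = tabulate (λ k → ⌊ k ≤? i ⌋ ∧ A j k)

  arrSet : Fin n → Subset n
  arrSet i = tabulate (λ k → ⌊ k ≤? i ⌋ ∧
                              any (λ j → ⌊ i <? j ⌋ ∧ A i j ∧ A j k) (allFin n))

-- (d,Δ)-degenerate w.r.t. the ordering σ.
-- Condition (2) "at most Δ subsets S" : all traces of later neighbours
-- lie in some list of at most Δ subsets.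
DegenerateOrd : ∀ {n} → Graph n → ℕ → ℕ → Ordering n → Set
DegenerateOrd G d Δ σ =
  ∀ i → (∣ backNbrs G σ i ∣ ≤ d)
      × Σ (List (Subset _)) (λ L → length L ≤ Δ ×
           (∀ j → i Data.Fin.< j → T (A G σ i j) → trace G σ i j ∈ L))

Degenerate : ∀ {n} → Graph n → ℕ → ℕ → Set
Degenerate {n} G d Δ = Σ (Ordering n) (DegenerateOrd G d Δ)

ArrangeableOrd : ∀ {n} → Graph n → ℕ → Ordering n → Set
ArrangeableOrd G p σ = ∀ i → ∣ arrSet G σ i ∣ ≤ p

Arrangeable : ∀ {n} → Graph n → ℕ → Set
Arrangeable {n} G p = Σ (Ordering n) (ArrangeableOrd G p)

-- Use the degeneracy ordering. Every k ≠ i in arrSet i lies in the trace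
-- N(v_j) ∩ {v_1,…,v_i} of some later neighbour v_j of v_i. Such a trace contains i and
-- consists of earlier neighbours of v_j, so it has at most d elements, at most d − 1 of
-- them other than i; and there are at most Δ distinct traces.
module Submission where

open import Defs hiding (sym)
open import Data.Nat using (ℕ; _+_; _*_; _∸_; z≤n; s≤s)
import Data.Nat as ℕ
import Data.Nat.Properties as ℕ
open import Data.Bool using (Bool; true; false; _∧_; T)
open import Data.Bool.Properties using (T-∧; T-≡)
open import Data.Bool.ListAction using (any)
open import Data.Fin as Fin using (Fin; _≤?_; _<?_; _≟_)
import Data.Fin.Properties as Fin
open import Data.Fin.Permutation using (_⟨$⟩ʳ_)
open import Data.Fin.Subset
open import Data.Fin.Subset.Properties
open import Data.Vec as Vec using (tabulate)
open import Data.Vec.Properties using (lookup∘tabulate; []=⇒lookup; lookup⇒[]=)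
open import Data.List using (List; _∷_; length; map; filter; allFin)
open import Data.List.Properties using (length-filter; length-map)
open import Data.List.Membership.Propositional using () renaming (_∈_ to _∈ˡ_)
open import Data.List.Membership.Propositional.Properties using (∈-map⁺; ∈-filter⁺)
open import Data.List.Relation.Unary.All as All using (All; []; _∷_)
import Data.List.Relation.Unary.All.Properties as Allₚ
open import Data.List.Relation.Unary.Any using (here; there; satisfied)
open import Data.List.Relation.Unary.Any.Properties using (any⁻)
open import Data.Product using (∃; _×_; _,_; proj₁; proj₂)
open import Data.Sum using (inj₁; inj₂)
open import Function using (_⇔_; mk⇔; Equivalence)
open Equivalence using (to; from)
open import Relation.Binary.PropositionalEquality using (refl; trans; sym; cong; subst)
open import Relation.Nullary using (yes; no; _×-dec_)
open import Relation.Unary using (Pred; Decidable)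
open import Relation.Nullary.Decidable using (⌊_⌋; toWitness; fromWitness)

private
  variable
    n : ℕ

∈-tabulate : (f : Fin n → Bool) {x : Fin n} → x ∈ tabulate f ⇔ T (f x)
∈-tabulate f {x} = mk⇔
  (λ x∈ → from T-≡ (trans (sym (lookup∘tabulate f x)) ([]=⇒lookup x∈)))
  (λ fx → lookup⇒[]= x (tabulate f) (trans (lookup∘tabulate f x) (to T-≡ fx)))

∣p∪q∣≤∣p∣+∣q∣ : (p q : Subset n) → ∣ p ∪ q ∣ ℕ.≤ ∣ p ∣ + ∣ q ∣
∣p∪q∣≤∣p∣+∣q∣ Vec.[]          Vec.[]          = z≤n
∣p∪q∣≤∣p∣+∣q∣ (true  Vec.∷ p) (true  Vec.∷ q) =
  s≤s (ℕ.≤-trans (∣p∪q∣≤∣p∣+∣q∣ p q) (ℕ.+-monoʳ-≤ ∣ p ∣ (ℕ.n≤1+n ∣ q ∣)))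
∣p∪q∣≤∣p∣+∣q∣ (true  Vec.∷ p) (false Vec.∷ q) = s≤s (∣p∪q∣≤∣p∣+∣q∣ p q)
∣p∪q∣≤∣p∣+∣q∣ (false Vec.∷ p) (true  Vec.∷ q) =
  ℕ.≤-trans (s≤s (∣p∪q∣≤∣p∣+∣q∣ p q)) (ℕ.≤-reflexive (sym (ℕ.+-suc ∣ p ∣ ∣ q ∣)))
∣p∪q∣≤∣p∣+∣q∣ (false Vec.∷ p) (false Vec.∷ q) = ∣p∪q∣≤∣p∣+∣q∣ p q

∣⋃ps∣≤length*bound : ∀ {b} {ps : List (Subset n)} →
                     All (λ p → ∣ p ∣ ℕ.≤ b) ps → ∣ ⋃ ps ∣ ℕ.≤ length ps * b
∣⋃ps∣≤length*bound {n} []         = ℕ.≤-reflexive (∣⊥∣≡0 n)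
∣⋃ps∣≤length*bound {ps = p ∷ ps} (∣p∣≤b ∷ bounded) =
  ℕ.≤-trans (∣p∪q∣≤∣p∣+∣q∣ p (⋃ ps)) (ℕ.+-mono-≤ ∣p∣≤b (∣⋃ps∣≤length*bound bounded))

x∈⋃⁺ : ∀ {x : Fin n} {p ps} → p ∈ˡ ps → x ∈ p → x ∈ ⋃ ps
x∈⋃⁺ (here refl) x∈p = x∈p∪q⁺ (inj₁ x∈p)
x∈⋃⁺ (there p∈ps) x∈p = x∈p∪q⁺ (inj₂ (x∈⋃⁺ p∈ps x∈p))

-- The common element i is counted once, not once per q.
∣p∣≤length*pred+1 : ∀ {b} {i : Fin n} {p : Subset n} (qs : List (Subset n)) →
                    All (λ q → ∣ q ∣ ℕ.≤ b × i ∈ q) qs →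
                    p ⊆ ⁅ i ⁆ ∪ ⋃ (map (_- i) qs) → ∣ p ∣ ℕ.≤ length qs * (b ∸ 1) + 1
∣p∣≤length*pred+1 {b = b} {i} {p} qs small p⊆ = begin
  ∣ p ∣                                    ≤⟨ p⊆q⇒∣p∣≤∣q∣ p⊆ ⟩
  ∣ ⁅ i ⁆ ∪ ⋃ (map (_- i) qs) ∣            ≤⟨ ∣p∪q∣≤∣p∣+∣q∣ ⁅ i ⁆ _ ⟩
  ∣ ⁅ i ⁆ ∣ + ∣ ⋃ (map (_- i) qs) ∣        ≡⟨ cong (_+ ∣ ⋃ (map (_- i) qs) ∣) (∣⁅x⁆∣≡1 i) ⟩
  1 + ∣ ⋃ (map (_- i) qs) ∣                ≤⟨ s≤s (∣⋃ps∣≤length*bound removed-small) ⟩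
  1 + length (map (_- i) qs) * (b ∸ 1)     ≡⟨ cong (λ m → 1 + m * (b ∸ 1)) (length-map (_- i) qs) ⟩
  1 + length qs * (b ∸ 1)                  ≡⟨ ℕ.+-comm 1 _ ⟩
  length qs * (b ∸ 1) + 1                  ∎
  where
  open ℕ.≤-Reasoning
  removed-small : All (λ q → ∣ q ∣ ℕ.≤ b ∸ 1) (map (_- i) qs)
  removed-small = Allₚ.map⁺ (All.map
    (λ (∣q∣≤b , i∈q) → ℕ.suc[m]≤n⇒m≤pred[n] (ℕ.≤-trans (x∈p⇒∣p-x∣<∣p∣ i∈q) ∣q∣≤b)) small)

module _ (G : Graph n) (σ : Ordering n) where

  ∈-backNbrs⁺ : ∀ {j k} → k Fin.< j → T (A G σ j k) → k ∈ backNbrs G σ j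
  ∈-backNbrs⁺ {j} {k} k<j j~k = from (∈-tabulate (λ k → ⌊ k <? j ⌋ ∧ A G σ j k))
                                     (from (T-∧ {⌊ k <? j ⌋}) (fromWitness k<j , j~k))

  ∈-trace⁺ : ∀ {i j k} → k Fin.≤ i → T (A G σ j k) → k ∈ trace G σ i j
  ∈-trace⁺ {i} {j} {k} k≤i j~k = from (∈-tabulate (λ k → ⌊ k ≤? i ⌋ ∧ A G σ j k))
                                      (from (T-∧ {⌊ k ≤? i ⌋}) (fromWitness k≤i , j~k))

  ∈-trace⁻ : ∀ {i j k} → k ∈ trace G σ i j → k Fin.≤ i × T (A G σ j k)
  ∈-trace⁻ {i} {j} {k} k∈trace
    with k≤i , j~k ← to (T-∧ {⌊ k ≤? i ⌋}) (to (∈-tabulate (λ k → ⌊ k ≤? i ⌋ ∧ A G σ j k)) k∈trace)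
    = toWitness k≤i , j~k

  ∈-arrSet⁻ : ∀ {i k} → k ∈ arrSet G σ i →
              k Fin.≤ i × ∃ λ j → i Fin.< j × T (A G σ i j) × T (A G σ j k)
  ∈-arrSet⁻ {i} {k} k∈arr
    with k≤i , later ← to (T-∧ {⌊ k ≤? i ⌋}) (to (∈-tabulate (λ k → ⌊ k ≤? i ⌋ ∧
                         any (λ j → ⌊ i <? j ⌋ ∧ A G σ i j ∧ A G σ j k) (allFin n))) k∈arr)
    with j , i<j∧path ← satisfied (any⁻ (λ j → ⌊ i <? j ⌋ ∧ A G σ i j ∧ A G σ j k) (allFin n) later)
    with i<j , path ← to (T-∧ {⌊ i <? j ⌋}) i<j∧path
    = toWitness k≤i , j , toWitness i<j , to (T-∧ {A G σ i j}) path

  module _ (i : Fin n) where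

    i∈trace : ∀ {j} → T (A G σ i j) → i ∈ trace G σ i j
    i∈trace {j} i~j =
      ∈-trace⁺ (Fin.≤-refl {x = i}) (subst T (Graph.sym G (σ ⟨$⟩ʳ i) (σ ⟨$⟩ʳ j)) i~j)

    trace⊆backNbrs : ∀ {j} → i Fin.< j → trace G σ i j ⊆ backNbrs G σ j
    trace⊆backNbrs i<j k∈trace with k≤i , j~k ← ∈-trace⁻ k∈trace =
      ∈-backNbrs⁺ (ℕ.≤-<-trans k≤i i<j) j~k

degenerateOrd⇒arrangeableOrd : ∀ (G : Graph n) d Δ σ →
                               DegenerateOrd G d Δ σ → ArrangeableOrd G (Δ * (d ∸ 1) + 1) σ
degenerateOrd⇒arrangeableOrd {n} G d Δ σ deg i
  with traces , ∣traces∣≤Δ , later-traces∈traces ← proj₂ (deg i) = begin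
  ∣ arrSet G σ i ∣                  ≤⟨ ∣p∣≤length*pred+1 small-traces (Allₚ.all-filter small? traces) cover ⟩
  length small-traces * (d ∸ 1) + 1 ≤⟨ ℕ.+-monoˡ-≤ 1 (ℕ.*-monoˡ-≤ (d ∸ 1) ∣small-traces∣≤Δ) ⟩
  Δ * (d ∸ 1) + 1                   ∎
  where
  open ℕ.≤-Reasoning

  -- The witness list may contain sets that are not traces; keep only those shaped like one.
  Small : Pred (Subset n) _
  Small S = ∣ S ∣ ℕ.≤ d × i ∈ S

  small? : Decidable Small
  small? S = ∣ S ∣ ℕ.≤? d ×-dec i ∈? S

  small-traces : List (Subset n)
  small-traces = filter small? traces

  ∣small-traces∣≤Δ : length small-traces ℕ.≤ Δ
  ∣small-traces∣≤Δ = ℕ.≤-trans (length-filter small? traces) ∣traces∣≤Δ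

  later-trace-small : ∀ {j} → i Fin.< j → T (A G σ i j) → Small (trace G σ i j)
  later-trace-small i<j i~j =
    ℕ.≤-trans (p⊆q⇒∣p∣≤∣q∣ (trace⊆backNbrs G σ i i<j)) (proj₁ (deg _)) , i∈trace G σ i i~j

  cover : arrSet G σ i ⊆ ⁅ i ⁆ ∪ ⋃ (map (_- i) small-traces)
  cover {k} k∈arr with k ≟ i | ∈-arrSet⁻ G σ k∈arr
  ... | yes refl | _ = x∈p∪q⁺ (inj₁ (x∈⁅x⁆ i))
  ... | no k≢i | k≤i , j , i<j , i~j , j~k =
    x∈p∪q⁺ (inj₂ (x∈⋃⁺ (∈-map⁺ (_- i) trace∈small-traces)
                       (x∈p∧x≢y⇒x∈p-y (∈-trace⁺ G σ k≤i j~k) k≢i)))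
    where
    trace∈small-traces : trace G σ i j ∈ˡ small-traces
    trace∈small-traces =
      ∈-filter⁺ small? (later-traces∈traces j i<j i~j) (later-trace-small i<j i~j)

lemma4p1 : ∀ {n} (G : Graph n) (d Δ : ℕ) → Degenerate G d Δ →
    Arrangeable G (Δ * (d ∸ 1) + 1)
lemma4p1 G d Δ (σ , deg) = σ , degenerateOrd⇒arrangeableOrd G d Δ σ deg
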